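{- Let $q\ge 2$ and $n\ge 1$ be integers, and let $S\subseteq [q]^n$ be nonempty, where $[q]=\{0,1,\dots,q-1\}$. Then $$|\Delta(S)|\ \ge\ \frac{\log |S|}{2\log(2nq)}.$$
   Context: For $x=(x_1,\dots,x_n),y=(y_1,\dots,y_n)\in[q]^n$ the Hamming distance is $d_H(x,y)=\#\{i: x_i\neq y_i\}$. For a set $S$, $\Delta(S)=\{d_H(x,y): x,y\in S\}$ is the set of Hamming distances determined by $S$ (pairs with $x=y$ allowed). The base of the logarithm is irrelevant since the bound is a ratio of logarithms. -}

module Defs where

open import Data.Nat using (ℕ; zero; suc; _+_)
open import Data.Fin using (Fin; _≟_)
open import Data.Vec using (Vec; []; _∷_)
open import Data.Bool using (if_then_else_)
open import Data.List using (List)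
open import Data.List.Membership.Propositional using (_∈_)
open import Data.Product using (∃; ∃-syntax; _×_)
open import Relation.Nullary using (does)
open import Relation.Binary.PropositionalEquality using (_≡_)

hamming : ∀ {q n} → Vec (Fin q) n → Vec (Fin q) n → ℕ
hamming [] [] = 0
hamming (x ∷ xs) (y ∷ ys) = (if does (x ≟ y) then 0 else 1) + hamming xs ys

-- d ∈ Δ(S): d is the Hamming distance of some pair x, y ∈ S (x = y allowed)
InΔ : ∀ {q n} → List (Vec (Fin q) n) → ℕ → Set
InΔ S d = ∃[ x ] ∃[ y ] (x ∈ S × y ∈ S × hamming x y ≡ d)

{-# OPTIONS --safe #-}

-- The rank method. Let P(x, y) be the product of d − hamming x y over the nonzero d ∈ D. On S × S the
-- matrix P is diagonal with nonzero diagonal, because two distinct points of S are at a nonzero distance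
-- lying in D. On the other hand hamming x y = Σᵢ Σₐ [xᵢ = a] [yᵢ ≠ a] is a sum of nq products f x · g y,
-- so P is a sum of (1 + nq)^|D| such products, i.e. P factors through ℤ^((1 + nq)^|D|). A diagonal
-- matrix with nonzero diagonal factoring through ℤ^N has size at most N: otherwise the rows of the left
-- factor would satisfy a nontrivial integer linear relation, and applying it to the diagonal matrix
-- gives a contradiction. Hence |S| ≤ (1 + nq)^|D| ≤ (2nq)^(2|D|).

module Submission where

open import Algebra.Bundles using (CommutativeMonoid; Semiring)
open import Data.Bool using (if_then_else_)
open import Data.Fin using (Fin; zero; suc; punchIn; punchOut; _↑ˡ_; _↑ʳ_; combine; remQuot; _≟_)
open import Data.Fin.Properties using (any?; punchInᵢ≢i; punchIn-punchOut; remQuot-combine)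
open import Data.Integer as ℤ using (ℤ; -_; 0ℤ; 1ℤ; -1ℤ; _+_; _-_; _*_)
open import Data.Integer.Properties as ℤ using (+-*-semiring)
open import Data.Integer.Tactic.RingSolver using (solve-∀)
open import Data.List using (List; []; _∷_; length; lookup)
open import Data.List.Membership.Propositional using (_∈_)
open import Data.List.Membership.Propositional.Properties using (∈-lookup)
import Data.List.Relation.Unary.All as All
open import Data.List.Relation.Unary.Any using (here; there)
open import Data.List.Relation.Unary.Unique.Propositional using (Unique; _∷_)
open import Data.Nat as ℕ using (ℕ; zero; suc; _≤_; s≤s; z≤n; _≤?_)
open import Data.Nat.Properties as ℕ using ()
open import Data.Product using (_×_; _,_)
open import Data.Sum using ([_,_]′)
open import Data.Vec using (Vec; []; _∷_; head; tail)
open import Data.Vec.Functional using (_++_)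
open import Data.Vec.Functional.Properties using (lookup-++ˡ; lookup-++ʳ)
open import Function using (_∘_)
open import Function.Bundles using (_⇔_; module Equivalence)
open import Relation.Binary.PropositionalEquality
  using (_≡_; _≢_; refl; sym; trans; cong; cong₂; subst; module ≡-Reasoning)
open import Relation.Nullary using (¬_; ¬?; yes; no; does; contradiction)
open import Relation.Nullary.Decidable using (decidable-stable; dec-true)

open import Defs

module FinSum {c ℓ} (M : CommutativeMonoid c ℓ) where

  module M = CommutativeMonoid M
  open M using (Carrier; _≈_; _∙_; ε; setoid; ∙-congˡ; identityˡ; identityʳ; assoc)
  open import Algebra.Properties.CommutativeMonoid.Sum M
    using (sum; sum-syntax; sum-remove; sum-cong-≋; sum-replicate-zero)
  open import Relation.Binary.Reasoning.Setoid setoid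

  ∑-↑ˡ↑ʳ : ∀ m {n} (f : Fin (m ℕ.+ n) → Carrier) →
           ∑[ k < m ℕ.+ n ] f k ≈ ∑[ i < m ] f (i ↑ˡ n) ∙ ∑[ j < n ] f (m ↑ʳ j)
  ∑-↑ˡ↑ʳ zero    f = M.sym (identityˡ _)
  ∑-↑ˡ↑ʳ (suc m) f = M.trans (∙-congˡ (∑-↑ˡ↑ʳ m (f ∘ suc))) (M.sym (assoc _ _ _))

  ∑-combine : ∀ m {n} (f : Fin (m ℕ.* n) → Carrier) →
              ∑[ k < m ℕ.* n ] f k ≈ ∑[ i < m ] ∑[ j < n ] f (combine i j)
  ∑-combine zero        f = M.refl
  ∑-combine (suc m) {n} f = M.trans (∑-↑ˡ↑ʳ n f) (∙-congˡ (∑-combine m (f ∘ (n ↑ʳ_))))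

  sum-single : ∀ {n} (f : Fin n → Carrier) i → (∀ j → j ≢ i → f j ≈ ε) → sum f ≈ f i
  sum-single {suc n} f i f≈ε = begin
    sum f                             ≈⟨ sum-remove {i = i} f ⟩
    f i ∙ ∑[ j < n ] f (punchIn i j)  ≈⟨ ∙-congˡ (sum-cong-≋ (λ j → f≈ε _ (punchInᵢ≢i i j))) ⟩
    f i ∙ ∑[ j < n ] ε                ≈⟨ ∙-congˡ (sum-replicate-zero n) ⟩
    f i ∙ ε                           ≈⟨ identityʳ (f i) ⟩
    f i                               ∎

open FinSum (Semiring.+-commutativeMonoid +-*-semiring)
open import Algebra.Properties.Semiring.Sum +-*-semiring
  using ( sum; sum-syntax; sum-cong-≗; sum-replicate-zero; ∑-distrib-+; ∑-comm
        ; *-distribˡ-sum; *-distribʳ-sum)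

*-≢0 : ∀ {a b} → a ≢ 0ℤ → b ≢ 0ℤ → a * b ≢ 0ℤ
*-≢0 {a} a≢0 b≢0 ab≡0 = [ a≢0 , b≢0 ]′ (ℤ.i*j≡0⇒i≡0∨j≡0 a ab≡0)

pivot-identity : ∀ {m} (μ a e : Fin m → ℤ) r b →
                 (- ∑[ i < m ] (μ i * a i)) * b + ∑[ i < m ] (r * μ i * e i) ≡
                 ∑[ i < m ] (μ i * (r * e i - a i * b))
pivot-identity {m} μ a e r b = begin
  (- μa) * b + ∑[ i < m ] (r * μ i * e i)
    ≡⟨ cong₂ _+_ (trans (sym (ℤ.neg-distribˡ-* μa b)) (ℤ.neg-distribʳ-* μa b))
                 (sum-cong-≗ {m} (λ i → ℤ.*-assoc r (μ i) (e i))) ⟩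
  μa * - b + ∑[ i < m ] (r * (μ i * e i))
    ≡⟨ cong (_+ ∑[ i < m ] (r * (μ i * e i))) (*-distribʳ-sum (- b) (λ i → μ i * a i)) ⟩
  ∑[ i < m ] (μ i * a i * - b) + ∑[ i < m ] (r * (μ i * e i))
    ≡⟨ ∑-distrib-+ (λ i → μ i * a i * - b) (λ i → r * (μ i * e i)) ⟨
  ∑[ i < m ] (μ i * a i * - b + r * (μ i * e i))
    ≡⟨ sum-cong-≗ {m} (λ i → expand (μ i) (a i) (e i) r b) ⟩
  ∑[ i < m ] (μ i * (r * e i - a i * b)) ∎
  where
  open ≡-Reasoning
  μa : ℤ
  μa = ∑[ i < m ] (μ i * a i)
  expand : ∀ x y z s t → x * y * - t + s * (x * z) ≡ x * (s * z - y * t)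
  expand = solve-∀

record LinearDependence {m N} (v : Fin m → Fin N → ℤ) : Set where
  field
    coeff           : Fin m → ℤ
    witness         : Fin m
    coeff-witness≢0 : coeff witness ≢ 0ℤ
    combination≡0   : ∀ t → ∑[ i < m ] (coeff i * v i t) ≡ 0ℤ

module _ {m N} (v : Fin (suc m) → Fin (suc N) → ℤ) where

  zeroRow-dependence : (∀ t → v zero t ≡ 0ℤ) → LinearDependence v
  zeroRow-dependence v₀≡0 = record
    { coeff           = e₀
    ; witness         = zero
    ; coeff-witness≢0 = λ ()
    ; combination≡0   = λ t → trans (sum-single (λ i → e₀ i * v i t) zero (e₀-off t))
                                    (trans (ℤ.*-identityˡ (v zero t)) (v₀≡0 t))
    }
    where
    e₀ : Fin (suc m) → ℤ
    e₀ zero    = 1ℤ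
    e₀ (suc _) = 0ℤ
    e₀-off : ∀ t j → j ≢ zero → e₀ j * v j t ≡ 0ℤ
    e₀-off t zero    0≢0 = contradiction refl 0≢0
    e₀-off t (suc j) _   = ℤ.*-zeroˡ (v (suc j) t)

  eliminate : Fin (suc N) → Fin m → Fin N → ℤ
  eliminate c i t = v zero c * v (suc i) (punchIn c t) - v (suc i) c * v zero (punchIn c t)

  -- Fraction-free Gaussian elimination with pivot r = v₀c: the rows r vᵢ₊₁ − vᵢ₊₁c v₀ vanish in
  -- column c, and a relation μ among them (column c dropped) lifts to the relation
  -- (− Σᵢ μᵢ vᵢ₊₁c , r μ) among the rows of v.
  pivot-dependence : ∀ c → v zero c ≢ 0ℤ → LinearDependence (eliminate c) → LinearDependence v
  pivot-dependence c r≢0 dep = record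
    { coeff           = coeff′
    ; witness         = suc witness
    ; coeff-witness≢0 = *-≢0 r≢0 coeff-witness≢0
    ; combination≡0   = λ t →
        trans (pivot-identity coeff (λ i → v (suc i) c) (λ i → v (suc i) t) r (v zero t)) (reduced t)
    }
    where
    open LinearDependence dep
    r : ℤ
    r = v zero c

    coeff′ : Fin (suc m) → ℤ
    coeff′ zero    = - ∑[ i < m ] (coeff i * v (suc i) c)
    coeff′ (suc i) = r * coeff i

    reduced : ∀ t → ∑[ i < m ] (coeff i * (r * v (suc i) t - v (suc i) c * v zero t)) ≡ 0ℤ
    reduced t with c ≟ t
    ... | yes refl = trans (sum-cong-≗ (λ i → cancel (coeff i) r (v (suc i) c))) (sum-replicate-zero m)
      where
      cancel : ∀ μ r x → μ * (r * x - x * r) ≡ 0ℤ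
      cancel = solve-∀
    ... | no c≢t = subst (λ t → ∑[ i < m ] (coeff i * (r * v (suc i) t - v (suc i) c * v zero t)) ≡ 0ℤ)
                         (punchIn-punchOut c≢t) (combination≡0 (punchOut c≢t))

linearDependence : ∀ {m N} → N ℕ.< m → (v : Fin m → Fin N → ℤ) → LinearDependence v
linearDependence {suc m} {zero} _ v = record
  { coeff = λ _ → 1ℤ ; witness = zero ; coeff-witness≢0 = λ () ; combination≡0 = λ () }
linearDependence {suc m} {suc N} (s≤s N<m) v with any? (λ t → ¬? (v zero t ℤ.≟ 0ℤ))
... | yes (c , v₀c≢0) = pivot-dependence v c v₀c≢0 (linearDependence N<m (eliminate v c))
... | no  ∄v₀t≢0      =
  zeroRow-dependence v (λ t → decidable-stable (v zero t ℤ.≟ 0ℤ) (∄v₀t≢0 ∘ (t ,_)))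

record FactorsThrough {A B : Set} (N : ℕ) (F : A → B → ℤ) : Set where
  field
    left       : A → Fin N → ℤ
    right      : Fin N → B → ℤ
    factorises : ∀ x y → F x y ≡ ∑[ k < N ] (left x k * right k y)

open FactorsThrough

module _ {A B : Set} where

  factorsThrough-resp : ∀ {N} {F G : A → B → ℤ} → (∀ x y → F x y ≡ G x y) →
                        FactorsThrough N F → FactorsThrough N G
  factorsThrough-resp F≡G F≈ = record
    { left       = left F≈
    ; right      = right F≈
    ; factorises = λ x y → trans (sym (F≡G x y)) (factorises F≈ x y)
    }

  factorsThrough-∘ : ∀ {A′ B′ : Set} {N} {F : A → B → ℤ} (f : A′ → A) (g : B′ → B) →
                     FactorsThrough N F → FactorsThrough N (λ x y → F (f x) (g y))
  factorsThrough-∘ f g F≈ = record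
    { left       = left F≈ ∘ f
    ; right      = λ k → right F≈ k ∘ g
    ; factorises = λ x y → factorises F≈ (f x) (g y)
    }

  factorsThrough-const : ∀ c → FactorsThrough {A} {B} 1 (λ _ _ → c)
  factorsThrough-const c = record
    { left       = λ _ _ → c
    ; right      = λ _ _ → 1ℤ
    ; factorises = λ _ _ → sym (trans (ℤ.+-identityʳ (c * 1ℤ)) (ℤ.*-identityʳ c))
    }

  factorsThrough-zero : ∀ {N} → FactorsThrough {A} {B} N (λ _ _ → 0ℤ)
  factorsThrough-zero {N} = record
    { left       = λ _ _ → 0ℤ
    ; right      = λ _ _ → 0ℤ
    ; factorises = λ _ _ → sym (sum-replicate-zero N)
    }

  factorsThrough-neg : ∀ {N} {F : A → B → ℤ} → FactorsThrough N F → FactorsThrough N (λ x y → - F x y)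
  factorsThrough-neg {N} {F} F≈ = record { left = λ x k → - f x k ; right = g ; factorises = negated }
    where
    open FactorsThrough F≈ using () renaming (left to f; right to g)
    neg-left : ∀ a b → -1ℤ * (a * b) ≡ - a * b
    neg-left = solve-∀
    negated : ∀ x y → - F x y ≡ ∑[ k < N ] (- f x k * g k y)
    negated x y = begin
      - F x y                               ≡⟨ cong -_ (factorises F≈ x y) ⟩
      - ∑[ k < N ] (f x k * g k y)          ≡⟨ ℤ.-1*i≡-i (∑[ k < N ] (f x k * g k y)) ⟨
      -1ℤ * ∑[ k < N ] (f x k * g k y)      ≡⟨ *-distribˡ-sum -1ℤ (λ k → f x k * g k y) ⟩
      ∑[ k < N ] (-1ℤ * (f x k * g k y))    ≡⟨ sum-cong-≗ {N} (λ k → neg-left (f x k) (g k y)) ⟩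
      ∑[ k < N ] (- f x k * g k y)          ∎
      where open ≡-Reasoning

  factorsThrough-+ : ∀ {M N} {F G : A → B → ℤ} → FactorsThrough M F → FactorsThrough N G →
                     FactorsThrough (M ℕ.+ N) (λ x y → F x y + G x y)
  factorsThrough-+ {M} {N} {F} {G} F≈ G≈ = record
    { left = λ x → f₁ x ++ f₂ x ; right = g₁ ++ g₂ ; factorises = summed }
    where
    open FactorsThrough F≈ using () renaming (left to f₁; right to g₁)
    open FactorsThrough G≈ using () renaming (left to f₂; right to g₂)
    summed : ∀ x y → F x y + G x y ≡ ∑[ k < M ℕ.+ N ] ((f₁ x ++ f₂ x) k * (g₁ ++ g₂) k y)
    summed x y = sym (begin
      ∑[ k < M ℕ.+ N ] ((f₁ x ++ f₂ x) k * (g₁ ++ g₂) k y)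
        ≡⟨ ∑-↑ˡ↑ʳ M _ ⟩
      ∑[ i < M ] ((f₁ x ++ f₂ x) (i ↑ˡ N) * (g₁ ++ g₂) (i ↑ˡ N) y)
        + ∑[ j < N ] ((f₁ x ++ f₂ x) (M ↑ʳ j) * (g₁ ++ g₂) (M ↑ʳ j) y)
        ≡⟨ cong₂ _+_
             (sum-cong-≗ {M} (λ i → cong₂ (λ a h → a * h y) (lookup-++ˡ (f₁ x) _ i) (lookup-++ˡ g₁ _ i)))
             (sum-cong-≗ {N} (λ j → cong₂ (λ a h → a * h y) (lookup-++ʳ (f₁ x) _ j) (lookup-++ʳ g₁ _ j))) ⟩
      ∑[ i < M ] (f₁ x i * g₁ i y) + ∑[ j < N ] (f₂ x j * g₂ j y)
        ≡⟨ cong₂ _+_ (factorises F≈ x y) (factorises G≈ x y) ⟨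
      F x y + G x y ∎)
      where open ≡-Reasoning

  factorsThrough-* : ∀ {M N} {F G : A → B → ℤ} → FactorsThrough M F → FactorsThrough N G →
                     FactorsThrough (M ℕ.* N) (λ x y → F x y * G x y)
  factorsThrough-* {M} {N} {F} {G} F≈ G≈ = record { left = f ; right = g ; factorises = multiplied }
    where
    open FactorsThrough F≈ using () renaming (left to f₁; right to g₁)
    open FactorsThrough G≈ using () renaming (left to f₂; right to g₂)
    f⊗ : A → Fin M × Fin N → ℤ
    f⊗ x (i , j) = f₁ x i * f₂ x j
    g⊗ : Fin M × Fin N → B → ℤ
    g⊗ (i , j) y = g₁ i y * g₂ j y
    f : A → Fin (M ℕ.* N) → ℤ
    f x = f⊗ x ∘ remQuot N
    g : Fin (M ℕ.* N) → B → ℤ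
    g = g⊗ ∘ remQuot N

    interchange : ∀ a b c d → a * b * (c * d) ≡ a * c * (b * d)
    interchange = solve-∀

    multiplied : ∀ x y → F x y * G x y ≡ ∑[ k < M ℕ.* N ] (f x k * g k y)
    multiplied x y = begin
      F x y * G x y
        ≡⟨ cong₂ _*_ (factorises F≈ x y) (factorises G≈ x y) ⟩
      ∑[ i < M ] (f₁ x i * g₁ i y) * ∑[ j < N ] (f₂ x j * g₂ j y)
        ≡⟨ *-distribʳ-sum _ (λ i → f₁ x i * g₁ i y) ⟩
      ∑[ i < M ] (f₁ x i * g₁ i y * ∑[ j < N ] (f₂ x j * g₂ j y))
        ≡⟨ sum-cong-≗ {M} (λ i → *-distribˡ-sum (f₁ x i * g₁ i y) (λ j → f₂ x j * g₂ j y)) ⟩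
      ∑[ i < M ] ∑[ j < N ] (f₁ x i * g₁ i y * (f₂ x j * g₂ j y))
        ≡⟨ sum-cong-≗ {M} (λ i → sum-cong-≗ {N} (λ j →
             trans (interchange (f₁ x i) (g₁ i y) (f₂ x j) (g₂ j y))
                   (sym (cong (λ p → f⊗ x p * g⊗ p y) (remQuot-combine i j))))) ⟩
      ∑[ i < M ] ∑[ j < N ] (f x (combine i j) * g (combine i j) y)
        ≡⟨ ∑-combine M (λ k → f x k * g k y) ⟨
      ∑[ k < M ℕ.* N ] (f x k * g k y) ∎
      where open ≡-Reasoning

factorsThrough-finite : ∀ {q} {B : Set} (F : Fin q → B → ℤ) → FactorsThrough q F
factorsThrough-finite {q} F = record
  { left = δ ; right = F ; factorises = λ a y → sym (trans (sum-single _ a (off a y)) (diag a y)) }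
  where
  δ : Fin q → Fin q → ℤ
  δ a k = if does (a ≟ k) then 1ℤ else 0ℤ
  diag : ∀ a y → δ a a * F a y ≡ F a y
  diag a y rewrite dec-true (a ≟ a) refl = ℤ.*-identityˡ (F a y)
  off : ∀ a y k → k ≢ a → δ a k * F k y ≡ 0ℤ
  off a y k k≢a with a ≟ k
  ... | yes a≡k = contradiction (sym a≡k) k≢a
  ... | no  _   = ℤ.*-zeroˡ (F k y)

diagonal-factorsThrough⇒≤ : ∀ {m N} (F : Fin m → Fin m → ℤ) → (∀ i → F i i ≢ 0ℤ) →
                            (∀ {i j} → i ≢ j → F i j ≡ 0ℤ) → FactorsThrough N F → m ≤ N
diagonal-factorsThrough⇒≤ {m} {N} F F-diag F-off F≈ with m ≤? N
... | yes m≤N = m≤N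
... | no  m≰N = contradiction (trans (sym single) vanishing) (*-≢0 coeff-witness≢0 (F-diag w))
  where
  open FactorsThrough F≈ using () renaming (left to f; right to g)
  open LinearDependence (linearDependence (ℕ.≰⇒> m≰N) f) renaming (witness to w)

  single : ∑[ k < m ] (coeff k * F k w) ≡ coeff w * F w w
  single = sum-single _ w (λ k k≢w → trans (cong (coeff k *_) (F-off k≢w)) (ℤ.*-zeroʳ (coeff k)))

  vanishing : ∑[ k < m ] (coeff k * F k w) ≡ 0ℤ
  vanishing = begin
    ∑[ k < m ] (coeff k * F k w)
      ≡⟨ sum-cong-≗ {m} (λ k → cong (coeff k *_) (factorises F≈ k w)) ⟩
    ∑[ k < m ] (coeff k * ∑[ a < N ] (f k a * g a w))
      ≡⟨ sum-cong-≗ {m} (λ k → *-distribˡ-sum (coeff k) (λ a → f k a * g a w)) ⟩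
    ∑[ k < m ] ∑[ a < N ] (coeff k * (f k a * g a w))
      ≡⟨ ∑-comm (λ k a → coeff k * (f k a * g a w)) ⟩
    ∑[ a < N ] ∑[ k < m ] (coeff k * (f k a * g a w))
      ≡⟨ sum-cong-≗ {N} (λ a → trans (sum-cong-≗ {m} (λ k → sym (ℤ.*-assoc (coeff k) (f k a) (g a w))))
                                     (sym (*-distribʳ-sum (g a w) (λ k → coeff k * f k a)))) ⟩
    ∑[ a < N ] (∑[ k < m ] (coeff k * f k a) * g a w)
      ≡⟨ sum-cong-≗ {N} (λ a → trans (cong (_* g a w) (combination≡0 a)) (ℤ.*-zeroˡ (g a w))) ⟩
    ∑[ a < N ] 0ℤ
      ≡⟨ sum-replicate-zero N ⟩
    0ℤ ∎
    where open ≡-Reasoning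

Unique⇒lookup-injective : ∀ {A : Set} {xs : List A} → Unique xs →
                          ∀ {i j} → lookup xs i ≡ lookup xs j → i ≡ j
Unique⇒lookup-injective (x∉ ∷ xs!) {zero}  {zero}  _  = refl
Unique⇒lookup-injective (x∉ ∷ xs!) {zero}  {suc j} eq = contradiction eq (All.lookup x∉ (∈-lookup j))
Unique⇒lookup-injective (x∉ ∷ xs!) {suc i} {zero}  eq = contradiction (sym eq) (All.lookup x∉ (∈-lookup i))
Unique⇒lookup-injective (x∉ ∷ xs!) {suc i} {suc j} eq = cong suc (Unique⇒lookup-injective xs! eq)

module _ {q : ℕ} where

  hamming-refl : ∀ {n} (x : Vec (Fin q) n) → hamming x x ≡ 0
  hamming-refl []      = refl
  hamming-refl (a ∷ x) rewrite dec-true (a ≟ a) refl = hamming-refl x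

  hamming≡0⇒≡ : ∀ {n} {x y : Vec (Fin q) n} → hamming x y ≡ 0 → x ≡ y
  hamming≡0⇒≡ {x = []}    {[]}    _ = refl
  hamming≡0⇒≡ {x = a ∷ x} {b ∷ y} d≡0 with a ≟ b
  ... | yes refl = cong (a ∷_) (hamming≡0⇒≡ d≡0)
  ... | no  _    = contradiction d≡0 λ ()

  hamming-factorsThrough : ∀ n → FactorsThrough (n ℕ.* q) (λ (x y : Vec (Fin q) n) → ℤ.+ hamming x y)
  hamming-factorsThrough zero    = factorsThrough-resp (λ { [] [] → refl }) factorsThrough-zero
  hamming-factorsThrough (suc n) =
    factorsThrough-resp (λ { (a ∷ x) (b ∷ y) → sym (ℤ.pos-+ _ (hamming x y)) })
      (factorsThrough-+ (factorsThrough-∘ head head (factorsThrough-finite mismatch))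
                        (factorsThrough-∘ tail tail (hamming-factorsThrough n)))
    where
    mismatch : Fin q → Fin q → ℤ
    mismatch a b = ℤ.+ (if does (a ≟ b) then 0 else 1)

  module _ {n : ℕ} where

    distanceFactor : ℕ → Vec (Fin q) n → Vec (Fin q) n → ℤ
    distanceFactor zero    _ _ = 1ℤ
    distanceFactor (suc d) x y = ℤ.+ suc d - ℤ.+ hamming x y

    annihilator : List ℕ → Vec (Fin q) n → Vec (Fin q) n → ℤ
    annihilator []      _ _ = 1ℤ
    annihilator (d ∷ D) x y = distanceFactor d x y * annihilator D x y

    distanceFactor-factorsThrough : ∀ d → FactorsThrough (suc (n ℕ.* q)) (distanceFactor d)
    distanceFactor-factorsThrough zero    =
      factorsThrough-resp (λ _ _ → ℤ.+-identityʳ 1ℤ)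
        (factorsThrough-+ (factorsThrough-const 1ℤ) factorsThrough-zero)
    distanceFactor-factorsThrough (suc d) =
      factorsThrough-+ (factorsThrough-const (ℤ.+ suc d)) (factorsThrough-neg (hamming-factorsThrough n))

    annihilator-factorsThrough : ∀ D → FactorsThrough (suc (n ℕ.* q) ℕ.^ length D) (annihilator D)
    annihilator-factorsThrough []      = factorsThrough-const 1ℤ
    annihilator-factorsThrough (d ∷ D) =
      factorsThrough-* (distanceFactor-factorsThrough d) (annihilator-factorsThrough D)

    distanceFactor-refl≢0 : ∀ d x → distanceFactor d x x ≢ 0ℤ
    distanceFactor-refl≢0 zero    x = λ ()
    distanceFactor-refl≢0 (suc d) x rewrite hamming-refl x = λ ()

    annihilator-refl≢0 : ∀ D x → annihilator D x x ≢ 0ℤ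
    annihilator-refl≢0 []      x = λ ()
    annihilator-refl≢0 (d ∷ D) x = *-≢0 (distanceFactor-refl≢0 d x) (annihilator-refl≢0 D x)

    distanceFactor-vanishes : ∀ {x y} → x ≢ y → distanceFactor (hamming x y) x y ≡ 0ℤ
    distanceFactor-vanishes {x} {y} x≢y with hamming x y in d≡h
    ... | zero  = contradiction (hamming≡0⇒≡ d≡h) x≢y
    ... | suc h = trans (cong (λ e → ℤ.+ suc h - ℤ.+ e) d≡h) (ℤ.+-inverseʳ (ℤ.+ suc h))

    annihilator-vanishes : ∀ D {x y} → hamming x y ∈ D → x ≢ y → annihilator D x y ≡ 0ℤ
    annihilator-vanishes (d ∷ D) {x} {y} (here refl) x≢y =
      trans (cong (_* annihilator D x y) (distanceFactor-vanishes x≢y)) (ℤ.*-zeroˡ (annihilator D x y))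
    annihilator-vanishes (d ∷ D) {x} {y} (there h∈D) x≢y =
      trans (cong (distanceFactor d x y *_) (annihilator-vanishes D h∈D x≢y)) (ℤ.*-zeroʳ (distanceFactor d x y))

[1+a]^k≤[2a]^[2k] : ∀ {a} k → 1 ≤ a → suc a ℕ.^ k ≤ (2 ℕ.* a) ℕ.^ (2 ℕ.* k)
[1+a]^k≤[2a]^[2k] {suc a} k (s≤s z≤n) = ℕ.≤-trans
  (ℕ.^-monoˡ-≤ k (ℕ.+-mono-≤ (s≤s {0} z≤n) (ℕ.≤-reflexive (sym (ℕ.+-identityʳ (suc a))))))
  (ℕ.^-monoʳ-≤ (2 ℕ.* suc a) (ℕ.m≤m+n k (k ℕ.+ 0)))

theorem1p2 : (q n : ℕ) → 2 ≤ q → 1 ≤ n →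
    (S : List (Vec (Fin q) n)) → Unique S → ¬ (length S ≡ 0) →
    (D : List ℕ) → Unique D → (∀ d → (d ∈ D) ⇔ InΔ S d) →
    length S ≤ (2 ℕ.* n ℕ.* q) ℕ.^ (2 ℕ.* length D)
theorem1p2 q n 2≤q 1≤n S S! _ D _ D≡Δ = begin
  length S
    ≤⟨ diagonal-factorsThrough⇒≤ P (annihilator-refl≢0 D ∘ point) P-off
         (factorsThrough-∘ point point (annihilator-factorsThrough D)) ⟩
  suc (n ℕ.* q) ℕ.^ length D
    ≤⟨ [1+a]^k≤[2a]^[2k] (length D) (ℕ.*-mono-≤ 1≤n (ℕ.≤-trans (s≤s z≤n) 2≤q)) ⟩
  (2 ℕ.* (n ℕ.* q)) ℕ.^ (2 ℕ.* length D)
    ≡⟨ cong (ℕ._^ (2 ℕ.* length D)) (ℕ.*-assoc 2 n q) ⟨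
  (2 ℕ.* n ℕ.* q) ℕ.^ (2 ℕ.* length D) ∎
  where
  open ℕ.≤-Reasoning
  point : Fin (length S) → Vec (Fin q) n
  point = lookup S
  P : Fin (length S) → Fin (length S) → ℤ
  P i j = annihilator D (point i) (point j)
  P-off : ∀ {i j} → i ≢ j → P i j ≡ 0ℤ
  P-off {i} {j} i≢j = annihilator-vanishes D
    (Equivalence.from (D≡Δ _) (point i , point j , ∈-lookup i , ∈-lookup j , refl))
    (i≢j ∘ Unique⇒lookup-injective S!)
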